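{- Let $G$ be a connected graph with maximum degree $\Delta(G)$, and let $\pi$ be a $prc$-partition of $G$. If $A\in\pi$, then $A$ forms a perfect coalition with at most $\Delta(G)$ members of $\pi$. Further, this bound is sharp: for every $\Delta\geq 2$ there exist a connected graph $G_\Delta$ with maximum degree $\Delta$ and a $prc$-partition of $G_\Delta$ containing a set that forms a perfect coalition with exactly $\Delta$ members of the partition.
   Context: All graphs are simple, finite and undirected. A set $S\subseteq V(G)$ is a dominating set if every vertex not in $S$ has a neighbor in $S$; $S$ is a perfect dominating set if every vertex in $V(G)\setminus S$ has exactly one neighbor in $S$. A perfect coalition in $G$ consists of two disjoint sets $V_1,V_2$ of vertices such that (i) neither $V_1$ nor $V_2$ is a dominating set of $G$; (ii) each vertex in $V(G)\setminus V_1$ has at most one neighbor in $V_1$, and each vertex in $V(G)\setminus V_2$ has at most one neighbor in $V_2$; (iii) $V_1\cup V_2$ is a perfect dominating set of $G$. A perfect coalition partition ($prc$-partition) of $G$ is a vertex partition $\pi=\{V_1,\dots,V_k\}$ such that each $V_i$ either is a singleton dominating set or forms a perfect coalition with some $V_j\in\pi$. -}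

module Defs where

open import Data.Nat using (ℕ; _≤_; _<_; zero; suc)
open import Data.Bool using (Bool; true; false)
open import Data.Fin using (Fin; _≟_)
open import Data.Fin.Subset using (Subset; _∈_; _∉_; _∩_; _∪_; ∣_∣; Empty)
open import Data.Vec using (tabulate)
open import Data.Product using (Σ; _×_; _,_; ∃; ∃-syntax)
open import Data.Sum using (_⊎_)
open import Relation.Binary.PropositionalEquality using (_≡_)
open import Relation.Nullary using (¬_)
open import Relation.Nullary.Decidable using (⌊_⌋)
open import Function.Definitions using (Injective; Surjective)

record Graph (n : ℕ) : Set where
  field
    adj    : Fin n → Fin n → Bool
    sym    : ∀ u v → adj u v ≡ adj v u
    irrefl : ∀ v → adj v v ≡ false
open Graph public

module _ {n : ℕ} (G : Graph n) where

  Adjacent : Fin n → Fin n → Set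
  Adjacent u v = adj G u v ≡ true

  N : Fin n → Subset n
  N v = tabulate (adj G v)

  degree : Fin n → ℕ
  degree v = ∣ N v ∣

  HasMaxDegree : ℕ → Set
  HasMaxDegree Δ = (∀ v → degree v ≤ Δ) × ∃[ v ] degree v ≡ Δ

  data Reach : Fin n → Fin n → Set where
    here : ∀ {v} → Reach v v
    step : ∀ {u w v} → Adjacent u w → Reach w v → Reach u v

  -- connected (a connected graph is nonempty)
  Connected : Set
  Connected = (0 < n) × (∀ u v → Reach u v)

  nbrsIn : Subset n → Fin n → ℕ
  nbrsIn S v = ∣ N v ∩ S ∣

  Dominating : Subset n → Set
  Dominating S = ∀ v → v ∉ S → ∃[ u ] (u ∈ S × Adjacent v u)

  PerfectDominating : Subset n → Set
  PerfectDominating S = ∀ v → v ∉ S → nbrsIn S v ≡ 1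

  Disjoint : Subset n → Subset n → Set
  Disjoint A B = Empty (A ∩ B)

  AtMostOneNbr : Subset n → Set
  AtMostOneNbr S = ∀ v → v ∉ S → nbrsIn S v ≤ 1

  PerfectCoalition : Subset n → Subset n → Set
  PerfectCoalition V₁ V₂ =
    Disjoint V₁ V₂ ×
    (¬ Dominating V₁) × (¬ Dominating V₂) ×
    AtMostOneNbr V₁ × AtMostOneNbr V₂ ×
    PerfectDominating (V₁ ∪ V₂)

  -- A vertex partition into k (nonempty) classes, given by a surjective
  -- class-assignment map.
  record Partition : Set where
    field
      k       : ℕ
      cls     : Fin n → Fin k
      cls-surj : Surjective _≡_ _≡_ cls
  open Partition public

  part : (π : Partition) → Fin (k π) → Subset n
  part π i = tabulate (λ v → ⌊ cls π v ≟ i ⌋)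

  Singleton : Subset n → Set
  Singleton S = ∃[ x ] (∀ v → v ∈ S → v ≡ x) × x ∈ S

  IsPrcPartition : Partition → Set
  IsPrcPartition π =
    ∀ i → (Singleton (part π i) × Dominating (part π i))
        ⊎ ∃[ j ] PerfectCoalition (part π i) (part π j)

{-# OPTIONS --safe #-}
module Submission where

-- Call a vertex undominated by A if it neither lies in A nor has a neighbour in A.
-- Suppose A forms perfect coalitions with m > Δ classes B₁, …, Bₘ, and let w be
-- undominated with a neighbour z that is adjacent to some a ∈ A. Then w has a
-- neighbour in every Bₜ: if w ∉ Bₜ, its unique neighbour in A ∪ Bₜ lies in Bₜ;
-- if w ∈ Bₜ, then z ∈ Bₜ, for otherwise z would have the two neighbours a and w
-- in A ∪ Bₜ. These m neighbours of w are distinct, contradicting deg w ≤ Δ. So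
-- the neighbours of an undominated vertex are undominated, and by connectivity
-- an undominated vertex would make every vertex, including those of A,
-- undominated. Hence A dominates G, which a member of a perfect coalition may not.
--
-- For sharpness take K₂,Δ partitioned into singletons: two singletons form a
-- perfect coalition as soon as their vertices lie on opposite sides, and a
-- vertex of the 2-side forms one with no other singleton.

open import Defs
open import Data.Bool using (Bool; true; false; _xor_)
open import Data.Bool.Properties using (T-≡; xor-same; xor-comm; xor-annihilates-not)
open import Data.Fin using (Fin; zero; suc; _≟_; fromℕ<)
open import Data.Fin.Properties using (suc-injective; 0≢1+n; any?)
open import Data.Fin.Subset using (Subset; _∈_; _∉_; _∩_; _∪_; ∣_∣; Nonempty; _-_)
open import Data.Fin.Subset.Properties
  using ( _∈?_; nonempty?; Empty-unique; ∣⊥∣≡0; x∈⁅y⁆⇔x≡y; ∣⁅x⁆∣≡1; p⊆q⇒∣p∣≤∣q∣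
        ; x∈p∩q⁺; x∈p∩q⁻; x∈p∪q⁺; x∈p∪q⁻; ∪-comm; ∣p∩q∣≤∣q∣
        ; x∈p∧x≢y⇒x∈p-y; x∈p⇒∣p-x∣<∣p∣ )
open import Data.Nat using (ℕ; zero; suc; _+_; _≤_; _<_; z≤n; s≤s; _≤?_)
open import Data.Nat.Properties using (≤-trans; ≤-reflexive; ≤-antisym; ≰⇒>; <⇒≱)
open import Data.Product using (Σ; _×_; _,_; ∃-syntax; proj₁; proj₂)
open import Data.Sum using (_⊎_; inj₁; inj₂)
import Data.Sum as Sum
open import Data.Vec using (tabulate)
open import Data.Vec.Properties using ([]=⇒lookup; lookup⇒[]=; lookup∘tabulate)
open import Function using (_∘_; id; Equivalence)
open import Function.Definitions using (Injective)
open import Relation.Binary.PropositionalEquality using (_≡_; _≢_; refl; trans; cong; subst)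
import Relation.Binary.PropositionalEquality as ≡
open import Relation.Nullary using (¬_; yes; no; contradiction)
open import Relation.Nullary.Decidable using (_×-dec_; toWitness; fromWitness; decidable-stable)
import Data.Bool as Bool

xor-cancelˡ : ∀ a b c → (a xor b) xor (a xor c) ≡ b xor c
xor-cancelˡ false b c = refl
xor-cancelˡ true  b c = xor-annihilates-not b c

module _ {n : ℕ} where

  ∈-tabulate⁺ : ∀ {h : Fin n → Bool} {v} → h v ≡ true → v ∈ tabulate h
  ∈-tabulate⁺ {h} {v} hv = lookup⇒[]= v (tabulate h) (trans (lookup∘tabulate h v) hv)

  ∈-tabulate⁻ : ∀ {h : Fin n → Bool} {v} → v ∈ tabulate h → h v ≡ true
  ∈-tabulate⁻ {h} {v} v∈ = trans (≡.sym (lookup∘tabulate h v)) ([]=⇒lookup v∈)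

  injection⇒≤∣p∣ : ∀ {r} {p : Subset n} {g : Fin r → Fin n} →
                   Injective _≡_ _≡_ g → (∀ t → g t ∈ p) → r ≤ ∣ p ∣
  injection⇒≤∣p∣ {zero}  _     _   = z≤n
  injection⇒≤∣p∣ {suc r} {p} {g} g-inj g∈p =
    ≤-trans (s≤s (injection⇒≤∣p∣ (suc-injective ∘ g-inj) g∘suc∈p-g₀))
            (x∈p⇒∣p-x∣<∣p∣ (g∈p zero))
    where
    g∘suc∈p-g₀ : ∀ t → g (suc t) ∈ p - g zero
    g∘suc∈p-g₀ t = x∈p∧x≢y⇒x∈p-y (g∈p (suc t)) (0≢1+n ∘ ≡.sym ∘ g-inj)

  x∈p∧y∈p∧x≢y⇒2≤∣p∣ : ∀ {p : Subset n} {x y} → x ∈ p → y ∈ p → x ≢ y → 2 ≤ ∣ p ∣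
  x∈p∧y∈p∧x≢y⇒2≤∣p∣ x∈p y∈p x≢y =
    ≤-trans (s≤s (≤-trans (s≤s z≤n) (x∈p⇒∣p-x∣<∣p∣ (x∈p∧x≢y⇒x∈p-y y∈p (x≢y ∘ ≡.sym)))))
            (x∈p⇒∣p-x∣<∣p∣ x∈p)

  unique-member⇒∣p∣≡1 : ∀ {p : Subset n} {x} → x ∈ p → (∀ {y} → y ∈ p → y ≡ x) → ∣ p ∣ ≡ 1
  unique-member⇒∣p∣≡1 {p} {x} x∈p unique = ≤-antisym ∣p∣≤1 (≤-trans (s≤s z≤n) (x∈p⇒∣p-x∣<∣p∣ x∈p))
    where
    ∣p∣≤1 : ∣ p ∣ ≤ 1
    ∣p∣≤1 = ≤-trans (p⊆q⇒∣p∣≤∣q∣ (Equivalence.from x∈⁅y⁆⇔x≡y ∘ unique)) (≤-reflexive (∣⁅x⁆∣≡1 x))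

  ∣p∣≡1⇒Nonempty : ∀ {p : Subset n} → ∣ p ∣ ≡ 1 → Nonempty p
  ∣p∣≡1⇒Nonempty {p} ∣p∣≡1 = decidable-stable (nonempty? p) λ empty →
    0≢1 (trans (≡.sym (∣⊥∣≡0 n)) (subst (λ q → ∣ q ∣ ≡ 1) (Empty-unique empty) ∣p∣≡1))
    where
    0≢1 : 0 ≢ 1
    0≢1 ()

module _ {n : ℕ} (G : Graph n) where

  Adjacent-sym : ∀ {u v} → Adjacent G u v → Adjacent G v u
  Adjacent-sym {u} {v} u~v = trans (Graph.sym G v u) u~v

  ∈N⁺ : ∀ {v u} → Adjacent G v u → u ∈ N G v
  ∈N⁺ = ∈-tabulate⁺

  ∈N⁻ : ∀ {v u} → u ∈ N G v → Adjacent G v u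
  ∈N⁻ = ∈-tabulate⁻

  Reach-trans : ∀ {u v w} → Reach G u v → Reach G v w → Reach G u w
  Reach-trans here          r = r
  Reach-trans (step u~x r′) r = step u~x (Reach-trans r′ r)

  Reach-sym : ∀ {u v} → Reach G u v → Reach G v u
  Reach-sym here         = here
  Reach-sym (step u~x r) = Reach-trans (Reach-sym r) (step (Adjacent-sym u~x) here)

  two-nbrs⇒¬PerfectDominating : ∀ {S v x y} → v ∉ S → x ∈ S → y ∈ S → x ≢ y →
                                Adjacent G v x → Adjacent G v y → ¬ PerfectDominating G S
  two-nbrs⇒¬PerfectDominating v∉S x∈S y∈S x≢y v~x v~y pd = 2≰1
    (subst (2 ≤_) (pd _ v∉S)
      (x∈p∧y∈p∧x≢y⇒2≤∣p∣ (x∈p∩q⁺ (∈N⁺ v~x , x∈S)) (x∈p∩q⁺ (∈N⁺ v~y , y∈S)) x≢y))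
    where
    2≰1 : ¬ 2 ≤ 1
    2≰1 (s≤s ())

  module _ (π : Partition G) where

    ∈part⁺ : ∀ {v j} → cls π v ≡ j → v ∈ part G π j
    ∈part⁺ {v} {j} e = ∈-tabulate⁺ (Equivalence.to T-≡ (fromWitness {a? = cls π v ≟ j} e))

    ∈part⁻ : ∀ {v j} → v ∈ part G π j → cls π v ≡ j
    ∈part⁻ {v} {j} v∈ = toWitness {a? = cls π v ≟ j} (Equivalence.from T-≡ (∈-tabulate⁻ v∈))

    part-nonempty : ∀ i → Nonempty (part G π i)
    part-nonempty i = let (v , cls-v≡i) = cls-surj π i in v , ∈part⁺ (cls-v≡i refl)

    nbrs-in-distinct-parts⇒≤degree : ∀ {m w} {f : Fin m → Fin (k π)} → Injective _≡_ _≡_ f →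
      (∀ t → ∃[ u ] u ∈ part G π (f t) × Adjacent G w u) → m ≤ degree G w
    nbrs-in-distinct-parts⇒≤degree {f = f} f-inj nbr =
      injection⇒≤∣p∣ nbr-inj (λ t → ∈N⁺ (proj₂ (proj₂ (nbr t))))
      where
      nbr-inj : Injective _≡_ _≡_ (proj₁ ∘ nbr)
      nbr-inj {t} {t′} e = f-inj (begin
        f t                     ≡⟨ ∈part⁻ (proj₁ (proj₂ (nbr t))) ⟨
        cls π (proj₁ (nbr t))   ≡⟨ cong (cls π) e ⟩
        cls π (proj₁ (nbr t′))  ≡⟨ ∈part⁻ (proj₁ (proj₂ (nbr t′))) ⟩
        f t′                    ∎)
        where open ≡.≡-Reasoning

  Undominated : Subset n → Fin n → Set
  Undominated A w = w ∉ A × (∀ u → u ∈ A → ¬ Adjacent G w u)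

  PerfectDominating⇒nbr-in-partner : ∀ {A B w z a} → PerfectDominating G (A ∪ B) →
    Undominated A w → Adjacent G w z → Adjacent G z a → a ∈ A → ∃[ u ] u ∈ B × Adjacent G w u
  PerfectDominating⇒nbr-in-partner {A} {B} {w} {z} {a} pd (w∉A , w↛A) w~z z~a a∈A with w ∈? B
  ... | yes w∈B = z , z∈B , w~z
    where
    z∈B : z ∈ B
    z∈B = decidable-stable (z ∈? B) λ z∉B →
      two-nbrs⇒¬PerfectDominating
        (Sum.[ (λ z∈A → w↛A z z∈A w~z) , z∉B ] ∘ x∈p∪q⁻ A B)
        (x∈p∪q⁺ (inj₁ a∈A)) (x∈p∪q⁺ (inj₂ w∈B)) (λ { refl → w∉A a∈A })
        z~a (Adjacent-sym w~z) pd
  ... | no w∉B with ∣p∣≡1⇒Nonempty (pd w (Sum.[ w∉A , w∉B ] ∘ x∈p∪q⁻ A B))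
  ...   | u , u∈ with x∈p∩q⁻ (N G w) (A ∪ B) u∈
  ...     | u∈N , u∈A∪B with x∈p∪q⁻ A B u∈A∪B
  ...       | inj₁ u∈A = contradiction (∈N⁻ u∈N) (w↛A u u∈A)
  ...       | inj₂ u∈B = u , u∈B , ∈N⁻ u∈N

  module _ (π : Partition G) {Δ m : ℕ} {A : Subset n} {f : Fin m → Fin (k π)}
           (degree≤Δ : ∀ v → degree G v ≤ Δ) (Δ<m : Δ < m) (f-inj : Injective _≡_ _≡_ f)
           (pd : ∀ t → PerfectDominating G (A ∪ part G π (f t))) where

    undominated-step : ∀ {w z} → Undominated A w → Adjacent G w z → Undominated A z
    undominated-step {w} (w∉A , w↛A) w~z = (λ z∈A → w↛A _ z∈A w~z) , λ a a∈A z~a →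
      <⇒≱ Δ<m (≤-trans
        (nbrs-in-distinct-parts⇒≤degree π f-inj λ t →
          PerfectDominating⇒nbr-in-partner (pd t) (w∉A , w↛A) w~z z~a a∈A)
        (degree≤Δ w))

    undominated-reach : ∀ {w v} → Reach G w v → Undominated A w → Undominated A v
    undominated-reach here         uw = uw
    undominated-reach (step w~z r) uw = undominated-reach r (undominated-step uw w~z)

    many-partners⇒Dominating : Connected G → Nonempty A → Dominating G A
    many-partners⇒Dominating (_ , reach) (a , a∈A) v v∉A
      with any? (λ u → (u ∈? A) ×-dec (adj G v u Bool.≟ true))
    ... | yes nbr = nbr
    ... | no ∄nbr = contradiction a∈A
      (proj₁ (undominated-reach (reach v a) (v∉A , λ u u∈A v~u → ∄nbr (u , u∈A , v~u))))

  perfectCoalition-partners≤maxDegree : ∀ (π : Partition G) {Δ m A} {f : Fin m → Fin (k π)} →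
    Connected G → (∀ v → degree G v ≤ Δ) → Nonempty A → Injective _≡_ _≡_ f →
    (∀ t → PerfectCoalition G A (part G π (f t))) → m ≤ Δ
  perfectCoalition-partners≤maxDegree π {Δ} {m} connected degree≤Δ ne f-inj coalition with m ≤? Δ
  ... | yes m≤Δ = m≤Δ
  ... | no m≰Δ = contradiction
    (many-partners⇒Dominating π degree≤Δ Δ<m f-inj
      (λ t → let (_ , _ , _ , _ , _ , pd) = coalition t in pd) connected ne)
    (proj₁ (proj₂ (coalition (fromℕ< Δ<m))))
    where
    Δ<m : Δ < m
    Δ<m = ≰⇒> m≰Δ

  discrete : Partition G
  discrete = record { k = n ; cls = id ; cls-surj = λ j → j , id }

  ∈singletons⁻ : ∀ {v} x y → v ∈ part G discrete x ∪ part G discrete y → v ≡ x ⊎ v ≡ y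
  ∈singletons⁻ x y = Sum.map (∈part⁻ discrete) (∈part⁻ discrete)
                           ∘ x∈p∪q⁻ (part G discrete x) (part G discrete y)

  singleton-¬Dominating : ∀ {x} → (∃[ w ] w ≢ x × ¬ Adjacent G w x) → ¬ Dominating G (part G discrete x)
  singleton-¬Dominating (w , w≢x , w≁x) dominating
    with dominating w (w≢x ∘ ∈part⁻ discrete)
  ... | u , u∈ , w~u with ∈part⁻ discrete u∈
  ...   | refl = w≁x w~u

  singleton-AtMostOneNbr : ∀ x → AtMostOneNbr G (part G discrete x)
  singleton-AtMostOneNbr x v _ = ≤-trans (∣p∩q∣≤∣q∣ (N G v) (part G discrete x))
    (≤-reflexive (unique-member⇒∣p∣≡1 (∈part⁺ discrete refl) (∈part⁻ discrete)))

  only-nbr⇒nbrsIn≡1 : ∀ {v x y} → Adjacent G v x → adj G v y ≡ false →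
                     nbrsIn G (part G discrete x ∪ part G discrete y) v ≡ 1
  only-nbr⇒nbrsIn≡1 {v} {x} {y} v~x v≁y =
    unique-member⇒∣p∣≡1 (x∈p∩q⁺ (∈N⁺ v~x , x∈p∪q⁺ (inj₁ (∈part⁺ discrete refl)))) unique
    where
    unique : ∀ {u} → u ∈ N G v ∩ (part G discrete x ∪ part G discrete y) → u ≡ x
    unique u∈ with x∈p∩q⁻ (N G v) _ u∈
    ... | u∈N , u∈S with ∈singletons⁻ x y u∈S
    ...   | inj₁ u≡x = u≡x
    ...   | inj₂ refl with trans (≡.sym (∈N⁻ u∈N)) v≁y
    ...     | ()

  singletons-PerfectDominating : ∀ {x y} →
    (∀ v → v ≢ x → v ≢ y → adj G v x xor adj G v y ≡ true) →
    PerfectDominating G (part G discrete x ∪ part G discrete y)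
  singletons-PerfectDominating {x} {y} exactly-one v v∉
    with adj G v x in v~x | adj G v y in v~y
       | exactly-one v (v∉ ∘ x∈p∪q⁺ ∘ inj₁ ∘ ∈part⁺ discrete) (v∉ ∘ x∈p∪q⁺ ∘ inj₂ ∘ ∈part⁺ discrete)
  ... | true  | false | _ = only-nbr⇒nbrsIn≡1 v~x v~y
  ... | false | true  | _ = subst (λ S → nbrsIn G S v ≡ 1) (∪-comm (part G discrete y) (part G discrete x))
                                 (only-nbr⇒nbrsIn≡1 v~y v~x)

  singletons-PerfectCoalition : ∀ {x y} → x ≢ y →
    (∃[ w ] w ≢ x × ¬ Adjacent G w x) → (∃[ w ] w ≢ y × ¬ Adjacent G w y) →
    (∀ v → v ≢ x → v ≢ y → adj G v x xor adj G v y ≡ true) →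
    PerfectCoalition G (part G discrete x) (part G discrete y)
  singletons-PerfectCoalition {x} {y} x≢y non-nbr-x non-nbr-y exactly-one =
      disjoint
    , singleton-¬Dominating non-nbr-x , singleton-¬Dominating non-nbr-y
    , singleton-AtMostOneNbr x , singleton-AtMostOneNbr y
    , singletons-PerfectDominating exactly-one
    where
    disjoint : Disjoint G (part G discrete x) (part G discrete y)
    disjoint (v , v∈) = let (v∈x , v∈y) = x∈p∩q⁻ (part G discrete x) _ v∈ in
      x≢y (trans (≡.sym (∈part⁻ discrete v∈x)) (∈part⁻ discrete v∈y))

reach-root⇒Connected : ∀ {n} (G : Graph (suc n)) r → (∀ v → Reach G v r) → Connected G
reach-root⇒Connected G r reach-r = s≤s z≤n , λ u v → Reach-trans G (reach-r u) (Reach-sym G (reach-r v))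

∣tabulate-true∣ : ∀ m → ∣ tabulate {n = m} (λ _ → true) ∣ ≡ m
∣tabulate-true∣ zero    = refl
∣tabulate-true∣ (suc m) = cong suc (∣tabulate-true∣ m)

∣tabulate-false∣ : ∀ m → ∣ tabulate {n = m} (λ _ → false) ∣ ≡ 0
∣tabulate-false∣ zero    = refl
∣tabulate-false∣ (suc m) = ∣tabulate-false∣ m

module CompleteBipartite (d : ℕ) where

  D : ℕ
  D = 2 + d

  hub₀ hub₁ : Fin (2 + D)
  hub₀ = zero
  hub₁ = suc zero

  leaf : Fin D → Fin (2 + D)
  leaf t = suc (suc t)

  leaf-injective : Injective _≡_ _≡_ leaf
  leaf-injective refl = refl

  isHub : Fin (2 + D) → Bool
  isHub zero          = true
  isHub (suc zero)    = true
  isHub (suc (suc _)) = false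

  K : Graph (2 + D)
  K = record
    { adj    = λ u v → isHub u xor isHub v
    ; sym    = λ u v → xor-comm (isHub u) (isHub v)
    ; irrefl = λ v → xor-same (isHub v)
    }

  K-connected : Connected K
  K-connected = reach-root⇒Connected K hub₀ reach-hub₀
    where
    reach-hub₀ : ∀ v → Reach K v hub₀
    reach-hub₀ zero          = here
    reach-hub₀ (suc zero)    = step {w = leaf zero} refl (step refl here)
    reach-hub₀ (suc (suc _)) = step refl here

  K-maxDegree : HasMaxDegree K D
  K-maxDegree = degree≤D , hub₀ , ∣tabulate-true∣ D
    where
    degree≤D : ∀ v → degree K v ≤ D
    degree≤D zero          = ≤-reflexive (∣tabulate-true∣ D)
    degree≤D (suc zero)    = ≤-reflexive (∣tabulate-true∣ D)
    degree≤D (suc (suc _)) = s≤s (s≤s (subst (_≤ d) (≡.sym (∣tabulate-false∣ D)) z≤n))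

  mate : Fin (2 + D) → Fin (2 + D)
  mate zero                = hub₁
  mate (suc zero)          = hub₀
  mate (suc (suc zero))    = leaf (suc zero)
  mate (suc (suc (suc _))) = leaf zero

  mate-≢ : ∀ v → mate v ≢ v
  mate-≢ zero                ()
  mate-≢ (suc zero)          ()
  mate-≢ (suc (suc zero))    ()
  mate-≢ (suc (suc (suc _))) ()

  mate-nonadjacent : ∀ v → ¬ Adjacent K (mate v) v
  mate-nonadjacent zero                ()
  mate-nonadjacent (suc zero)          ()
  mate-nonadjacent (suc (suc zero))    ()
  mate-nonadjacent (suc (suc (suc _))) ()

  opposite : Fin (2 + D) → Fin (2 + D)
  opposite zero          = leaf zero
  opposite (suc zero)    = leaf zero
  opposite (suc (suc _)) = hub₀

  opposite-side : ∀ v → isHub v xor isHub (opposite v) ≡ true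
  opposite-side zero          = refl
  opposite-side (suc zero)    = refl
  opposite-side (suc (suc _)) = refl

  K-PerfectCoalition : ∀ x y → isHub x xor isHub y ≡ true →
    PerfectCoalition K (part K (discrete K) x) (part K (discrete K) y)
  K-PerfectCoalition x y opposite-sides = singletons-PerfectCoalition K x≢y
    (mate x , mate-≢ x , mate-nonadjacent x) (mate y , mate-≢ y , mate-nonadjacent y)
    (λ v _ _ → trans (xor-cancelˡ (isHub v) (isHub x) (isHub y)) opposite-sides)
    where
    x≢y : x ≢ y
    x≢y refl with trans (≡.sym (xor-same (isHub x))) opposite-sides
    ... | ()

  K-prc : IsPrcPartition K (discrete K)
  K-prc v = inj₂ (opposite v , K-PerfectCoalition v (opposite v) (opposite-side v))

  hub₀-PerfectCoalition⇒leaf : ∀ j →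
    PerfectCoalition K (part K (discrete K) hub₀) (part K (discrete K) j) → ∃[ t ] leaf t ≡ j
  hub₀-PerfectCoalition⇒leaf zero (disjoint , _) =
    contradiction (hub₀ , x∈p∩q⁺ (∈part⁺ K (discrete K) refl , ∈part⁺ K (discrete K) refl)) disjoint
  hub₀-PerfectCoalition⇒leaf (suc zero) (_ , _ , _ , _ , _ , pd) = contradiction pd
    (two-nbrs⇒¬PerfectDominating K leaf₀∉
      (x∈p∪q⁺ {p = A} {B} (inj₁ hub₀∈A)) (x∈p∪q⁺ {p = A} {B} (inj₂ hub₁∈B)) (λ ()) refl refl)
    where
    A B : Subset (2 + D)
    A = part K (discrete K) hub₀
    B = part K (discrete K) hub₁
    hub₀∈A : hub₀ ∈ A
    hub₀∈A = ∈part⁺ K (discrete K) refl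
    hub₁∈B : hub₁ ∈ B
    hub₁∈B = ∈part⁺ K (discrete K) refl
    leaf₀∉ : leaf zero ∉ A ∪ B
    leaf₀∉ leaf₀∈ with ∈singletons⁻ K hub₀ hub₁ leaf₀∈
    ... | inj₁ ()
    ... | inj₂ ()
  hub₀-PerfectCoalition⇒leaf (suc (suc t)) _ = t , refl

theorem2p3 :
    (∀ (n : ℕ) (G : Graph n) (Δ : ℕ) → Connected G → HasMaxDegree G Δ →
      (π : Partition G) → IsPrcPartition G π → (i : Fin (k π)) →
      ∀ (m : ℕ) (f : Fin m → Fin (k π)) → Injective _≡_ _≡_ f →
      (∀ t → PerfectCoalition G (part G π i) (part G π (f t))) → m ≤ Δ)
    ×
    (∀ (Δ : ℕ) → 2 ≤ Δ →
      ∃[ n ] Σ (Graph n) λ G → Connected G × HasMaxDegree G Δ ×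
        Σ (Partition G) λ π → IsPrcPartition G π ×
          ∃[ i ] Σ (Fin Δ → Fin (k π)) λ f → Injective _≡_ _≡_ f ×
            (∀ t → PerfectCoalition G (part G π i) (part G π (f t))) ×
            (∀ j → PerfectCoalition G (part G π i) (part G π j) → ∃[ t ] f t ≡ j))
theorem2p3 =
  -- The bound uses only the coalitions of the class i, not that π is a prc-partition.
    (λ n G Δ connected (degree≤Δ , _) π _ i m f f-inj coalition →
       perfectCoalition-partners≤maxDegree G π connected degree≤Δ (part-nonempty G π i) f-inj coalition)
  , λ { (suc (suc d)) (s≤s (s≤s z≤n)) → let open CompleteBipartite d in
          2 + D , K , K-connected , K-maxDegree , discrete K , K-prc
        , hub₀ , leaf , leaf-injective , (λ t → K-PerfectCoalition hub₀ (leaf t) refl) , hub₀-PerfectCoalition⇒leaf }
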